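{- Let $m\ge2$ be an integer. There is a bijection $[\mathcal{A}_m]_m\to\mathcal{A}_m^m$, $\pi\mapsto(\lambda^{(1)},\ldots,\lambda^{(m)})$, such that $|\pi|=m\cdot(|\lambda^{(1)}|+\cdots+|\lambda^{(m)}|)$ and $\ell(\pi)=\ell(\lambda^{(1)})+\cdots+\ell(\lambda^{(m)})$. As a consequence, the numbers $a_m(n)$ defined by $\sum_{n\ge0}a_m(n)q^n=\prod_{k\ge0}(1+q^{m^k})^{m^k}$ form an $m$-convolutive sequence, i.e. $\sum_{n\ge0}a_m(mn)q^n=\big(\sum_{n\ge0}a_m(n)q^n\big)^m$.
   Context: A colored $m$-ary strict partition is a finite multiset of parts, each part being a power $m^k$ ($k\ge0$) carrying a color $c\in\{1,\ldots,m^k\}$, such that no two parts have both the same size and the same color. $\mathcal{A}_m$ denotes the set of colored $m$-ary strict partitions; for $\pi\in\mathcal{A}_m$, $|\pi|$ is the sum of the part sizes and $\ell(\pi)$ is the number of parts. The numbers $a_m(n)$ count the elements of $\mathcal{A}_m$ of weight $n$. $[\mathcal{A}_m]_m$ denotes the subset of $\mathcal{A}_m$ of members whose weight is a multiple of $m$, and $\mathcal{A}_m^m$ is the $m$-fold Cartesian product. -}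

module Defs where

open import Data.Nat using (ℕ; zero; suc; _+_; _*_; _∸_; _^_; _<_; _≡ᵇ_)
open import Data.Fin using (Fin; toℕ)
open import Data.Bool using (if_then_else_)
open import Data.List using (List; map; length; upTo)
open import Data.Nat.ListAction using (sum)
open import Data.List.Relation.Unary.Linked using (Linked)
open import Data.Product using (Σ; _×_; _,_; proj₁)
open import Data.Sum using (_⊎_)
open import Data.Nat.Divisibility using (_∣_)
open import Relation.Binary.PropositionalEquality using (_≡_)

-- A colored part: the pair (k , c) stands for the part m^k with color
-- c ∈ {1,…,m^k}, colors being represented by Fin (m ^ k) (0-based).
Part : ℕ → Set
Part m = Σ ℕ (λ k → Fin (m ^ k))

size : {m : ℕ} → Part m → ℕ
size {m} p = m ^ proj₁ p

_<ₚ_ : {m : ℕ} → Part m → Part m → Set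
(k , c) <ₚ (k′ , c′) = k < k′ ⊎ (k ≡ k′ × toℕ c < toℕ c′)

-- A colored m-ary strict partition: a finite set of colored parts,
-- represented canonically as a strictly increasing list of parts.
-- (Strictness encodes that no (size, color) pair is repeated.)
𝒜 : ℕ → Set
𝒜 m = Σ (List (Part m)) (Linked (_<ₚ_ {m}))

∣_∣ₚ : {m : ℕ} → 𝒜 m → ℕ
∣ π ∣ₚ = sum (map size (proj₁ π))

ℓ : {m : ℕ} → 𝒜 m → ℕ
ℓ π = length (proj₁ π)

[𝒜]ₘ : ℕ → Set
[𝒜]ₘ m = Σ (𝒜 m) (λ π → m ∣ ∣ π ∣ₚ)

Series : Set
Series = ℕ → ℕ

_⊛_ : Series → Series → Series
(f ⊛ g) n = sum (map (λ i → f i * g (n ∸ i)) (upTo (suc n)))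

𝟙 : Series
𝟙 zero    = 1
𝟙 (suc _) = 0

_^ₛ_ : Series → ℕ → Series
f ^ₛ zero  = 𝟙
f ^ₛ suc j = f ⊛ (f ^ₛ j)

1+q^ : ℕ → Series
1+q^ d n = (if n ≡ᵇ 0 then 1 else 0) + (if n ≡ᵇ d then 1 else 0)

∏factors : ℕ → ℕ → Series
∏factors m zero    = 𝟙
∏factors m (suc N) = ∏factors m N ⊛ (1+q^ (m ^ N) ^ₛ (m ^ N))

-- a_m(n): coefficient of q^n in ∏_{k ≥ 0} (1 + q^{m^k})^{m^k}.
-- For m ≥ 2 the factors with k > n are ≡ 1 modulo q^{n+1}
-- (since m^k ≥ 2^k > n), so the coefficient of q^n in the infinite
-- product equals that of the finite product over k < n + 1.
a : ℕ → ℕ → ℕ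
a m n = ∏factors m (suc n) n

{-# OPTIONS --safe #-}
-- A colour c < m · m^e of a part m^(e+1) is written c = j · m^e + c′ with j < m and c′ < m^e, so
-- (m^(e+1), c) ↦ (j, (m^e, c′)) identifies the parts of size > 1 with pairs (j, part) and divides
-- sizes by m. A partition whose weight is a multiple of m has no part of size 1 (there is only
-- one such part, and all other parts are multiples of m), so sorting its parts by j gives m
-- partitions with total weight |π|/m and total length ℓ(π); merging the lifted parts inverts this.
--
-- For the series, let P_N = ∏_{k<N} (1 + q^(m^k))^(m^k). Taking the m-section f ↦ Σ f(mn) qⁿ is
-- multiplicative on products one of whose factors is a series in q^m, and it sends
-- (1 + q^(m^(k+1)))^(m^(k+1)) to ((1 + q^(m^k))^(m^k))^m; by induction the m-section of P_(N+1)
-- is P_N^m. The factor (1 + q^(m^N))^(m^N) is 1 modulo q^(m^N) and N < m^N, so P_N agrees with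
-- the infinite product below degree N, and the identity passes to the coefficients a_m(n).
module Submission where

open import Defs

module PowerSeries where

  open import Level using (0ℓ)
  open import Algebra.Bundles using (CommutativeMonoid)
  open import Algebra.Structures.Biased using (isCommutativeMonoidˡ)
  open import Data.Bool using (Bool; if_then_else_)
  open import Data.List using (upTo)
  open import Data.List.Properties using (map-applyUpTo; map-cong)
  open import Data.Nat
  open import Data.Nat.Properties
  open import Data.Nat.Divisibility using (_∣_; _∣0; n∣m*n; m∣m*n; ∣m+n∣m⇒∣n; >⇒∤)
  open import Data.Nat.ListAction using (sum)
  open import Data.Nat.Tactic.RingSolver using (solve-∀)
  open import Algebra.Properties.CommutativeSemigroup +-commutativeSemigroup using (x∙yz≈y∙xz)
  open import Function.Bundles using (mk⇔)
  open import Relation.Binary.Bundles using (Setoid)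
  open import Relation.Binary.PropositionalEquality
  import Relation.Binary.Reasoning.Setoid as SetoidReasoning
  open import Relation.Nullary using (¬_)
  open import Relation.Nullary.Decidable using (dec-false; does-⇔)

  tail : Series → Series
  tail f n = f (suc n)

  ⊛-zero : ∀ f g → (f ⊛ g) 0 ≡ f 0 * g 0
  ⊛-zero f g = +-identityʳ (f 0 * g 0)

  ⊛-suc : ∀ f g n → (f ⊛ g) (suc n) ≡ f 0 * g (suc n) + (tail f ⊛ g) n
  ⊛-suc f g n = cong (λ s → f 0 * g (suc n) + sum s)
    (trans (map-applyUpTo suc h (suc n)) (sym (map-applyUpTo (λ i → i) (λ i → h (suc i)) (suc n))))
    where h = λ i → f i * g (suc n ∸ i)

  ⊛-cong : ∀ {f f′ g g′} → f ≗ f′ → g ≗ g′ → f ⊛ g ≗ f′ ⊛ g′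
  ⊛-cong f≗f′ g≗g′ n = cong sum (map-cong (λ i → cong₂ _*_ (f≗f′ i) (g≗g′ (n ∸ i))) (upTo (suc n)))

  𝟘 : Series
  𝟘 _ = 0

  ⊛-zeroˡ : ∀ g → 𝟘 ⊛ g ≗ 𝟘
  ⊛-zeroˡ g zero    = ⊛-zero 𝟘 g
  ⊛-zeroˡ g (suc n) = trans (⊛-suc 𝟘 g n) (⊛-zeroˡ g n)

  ⊛-identityˡ : ∀ g → 𝟙 ⊛ g ≗ g
  ⊛-identityˡ g zero    = trans (⊛-zero 𝟙 g) (+-identityʳ (g 0))
  ⊛-identityˡ g (suc n) = begin
    (𝟙 ⊛ g) (suc n)            ≡⟨ ⊛-suc 𝟙 g n ⟩
    g (suc n) + 0 + (𝟘 ⊛ g) n  ≡⟨ cong₂ _+_ (+-identityʳ (g (suc n))) (⊛-zeroˡ g n) ⟩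
    g (suc n) + 0              ≡⟨ +-identityʳ (g (suc n)) ⟩
    g (suc n)                  ∎
    where open ≡-Reasoning

  ⊛-comm : ∀ f g → f ⊛ g ≗ g ⊛ f
  ⊛-comm f g zero = begin
    (f ⊛ g) 0  ≡⟨ ⊛-zero f g ⟩
    f 0 * g 0  ≡⟨ *-comm (f 0) (g 0) ⟩
    g 0 * f 0  ≡⟨ ⊛-zero g f ⟨
    (g ⊛ f) 0  ∎
    where open ≡-Reasoning
  ⊛-comm f g (suc zero) = begin
    (f ⊛ g) 1                  ≡⟨ ⊛-suc f g 0 ⟩
    f 0 * g 1 + (tail f ⊛ g) 0 ≡⟨ cong (f 0 * g 1 +_) (⊛-zero (tail f) g) ⟩
    f 0 * g 1 + f 1 * g 0      ≡⟨ +-comm (f 0 * g 1) (f 1 * g 0) ⟩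
    f 1 * g 0 + f 0 * g 1      ≡⟨ cong₂ _+_ (*-comm (f 1) (g 0)) (*-comm (f 0) (g 1)) ⟩
    g 0 * f 1 + g 1 * f 0      ≡⟨ cong (g 0 * f 1 +_) (⊛-zero (tail g) f) ⟨
    g 0 * f 1 + (tail g ⊛ f) 0 ≡⟨ ⊛-suc g f 0 ⟨
    (g ⊛ f) 1                  ∎
    where open ≡-Reasoning
  ⊛-comm f g (suc (suc n)) = begin
    (f ⊛ g) (2 + n)                           ≡⟨ ⊛-suc f g (suc n) ⟩
    A + (tail f ⊛ g) (suc n)                  ≡⟨ cong (A +_) (⊛-comm (tail f) g (suc n)) ⟩
    A + (g ⊛ tail f) (suc n)                  ≡⟨ cong (A +_) (⊛-suc g (tail f) n) ⟩
    A + (B + (tail g ⊛ tail f) n)             ≡⟨ cong (λ h → A + (B + h)) (⊛-comm (tail g) (tail f) n) ⟩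
    A + (B + (tail f ⊛ tail g) n)             ≡⟨ x∙yz≈y∙xz A B _ ⟩
    B + (A + (tail f ⊛ tail g) n)             ≡⟨ cong (B +_) (⊛-suc f (tail g) n) ⟨
    B + (f ⊛ tail g) (suc n)                  ≡⟨ cong (B +_) (⊛-comm f (tail g) (suc n)) ⟩
    B + (tail g ⊛ f) (suc n)                  ≡⟨ ⊛-suc g f (suc n) ⟨
    (g ⊛ f) (2 + n)                           ∎
    where
    open ≡-Reasoning
    A = f 0 * g (2 + n)
    B = g 0 * f (2 + n)

  ⊛-linearˡ : ∀ c u v h n → ((λ i → c * u i + v i) ⊛ h) n ≡ c * (u ⊛ h) n + (v ⊛ h) n
  ⊛-linearˡ c u v h zero = begin
    ((λ i → c * u i + v i) ⊛ h) 0  ≡⟨ ⊛-zero (λ i → c * u i + v i) h ⟩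
    (c * u 0 + v 0) * h 0          ≡⟨ rearrange c (u 0) (v 0) (h 0) ⟩
    c * (u 0 * h 0) + v 0 * h 0    ≡⟨ cong₂ (λ x y → c * x + y) (⊛-zero u h) (⊛-zero v h) ⟨
    c * (u ⊛ h) 0 + (v ⊛ h) 0      ∎
    where
    open ≡-Reasoning
    rearrange : ∀ c x y z → (c * x + y) * z ≡ c * (x * z) + y * z
    rearrange = solve-∀
  ⊛-linearˡ c u v h (suc n) = begin
    ((λ i → c * u i + v i) ⊛ h) (suc n)
      ≡⟨ ⊛-suc (λ i → c * u i + v i) h n ⟩
    (c * u 0 + v 0) * h (suc n) + ((λ i → c * tail u i + tail v i) ⊛ h) n
      ≡⟨ cong ((c * u 0 + v 0) * h (suc n) +_) (⊛-linearˡ c (tail u) (tail v) h n) ⟩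
    (c * u 0 + v 0) * h (suc n) + (c * (tail u ⊛ h) n + (tail v ⊛ h) n)
      ≡⟨ rearrange c (u 0) (v 0) (h (suc n)) _ _ ⟩
    c * (u 0 * h (suc n) + (tail u ⊛ h) n) + (v 0 * h (suc n) + (tail v ⊛ h) n)
      ≡⟨ cong₂ (λ x y → c * x + y) (⊛-suc u h n) (⊛-suc v h n) ⟨
    c * (u ⊛ h) (suc n) + (v ⊛ h) (suc n)
      ∎
    where
    open ≡-Reasoning
    rearrange : ∀ c x y z a b → (c * x + y) * z + (c * a + b) ≡ c * (x * z + a) + (y * z + b)
    rearrange = solve-∀

  ⊛-assoc : ∀ f g h → (f ⊛ g) ⊛ h ≗ f ⊛ (g ⊛ h)
  ⊛-assoc f g h zero = begin
    ((f ⊛ g) ⊛ h) 0    ≡⟨ ⊛-zero (f ⊛ g) h ⟩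
    (f ⊛ g) 0 * h 0    ≡⟨ cong (_* h 0) (⊛-zero f g) ⟩
    f 0 * g 0 * h 0    ≡⟨ *-assoc (f 0) (g 0) (h 0) ⟩
    f 0 * (g 0 * h 0)  ≡⟨ cong (f 0 *_) (⊛-zero g h) ⟨
    f 0 * (g ⊛ h) 0    ≡⟨ ⊛-zero f (g ⊛ h) ⟨
    (f ⊛ (g ⊛ h)) 0    ∎
    where open ≡-Reasoning
  ⊛-assoc f g h (suc n) = begin
    ((f ⊛ g) ⊛ h) (suc n)
      ≡⟨ ⊛-suc (f ⊛ g) h n ⟩
    (f ⊛ g) 0 * h (suc n) + (tail (f ⊛ g) ⊛ h) n
      ≡⟨ cong₂ _+_ (cong (_* h (suc n)) (⊛-zero f g)) (⊛-cong {g = h} (⊛-suc f g) (λ _ → refl) n) ⟩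
    f 0 * g 0 * h (suc n) + ((λ i → f 0 * tail g i + (tail f ⊛ g) i) ⊛ h) n
      ≡⟨ cong (f 0 * g 0 * h (suc n) +_) (⊛-linearˡ (f 0) (tail g) (tail f ⊛ g) h n) ⟩
    f 0 * g 0 * h (suc n) + (f 0 * (tail g ⊛ h) n + ((tail f ⊛ g) ⊛ h) n)
      ≡⟨ cong (λ x → f 0 * g 0 * h (suc n) + (f 0 * (tail g ⊛ h) n + x)) (⊛-assoc (tail f) g h n) ⟩
    f 0 * g 0 * h (suc n) + (f 0 * (tail g ⊛ h) n + (tail f ⊛ (g ⊛ h)) n)
      ≡⟨ rearrange (f 0) (g 0) (h (suc n)) _ _ ⟩
    f 0 * (g 0 * h (suc n) + (tail g ⊛ h) n) + (tail f ⊛ (g ⊛ h)) n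
      ≡⟨ cong (λ x → f 0 * x + (tail f ⊛ (g ⊛ h)) n) (⊛-suc g h n) ⟨
    f 0 * (g ⊛ h) (suc n) + (tail f ⊛ (g ⊛ h)) n
      ≡⟨ ⊛-suc f (g ⊛ h) n ⟨
    (f ⊛ (g ⊛ h)) (suc n)
      ∎
    where
    open ≡-Reasoning
    rearrange : ∀ a b c d e → a * b * c + (a * d + e) ≡ a * (b * c + d) + e
    rearrange = solve-∀

  ⊛-commutativeMonoid : CommutativeMonoid 0ℓ 0ℓ
  ⊛-commutativeMonoid = record
    { Carrier             = Series
    ; _≈_                 = _≗_
    ; _∙_                 = _⊛_
    ; ε                   = 𝟙
    ; isCommutativeMonoid = isCommutativeMonoidˡ record
      { isSemigroup = record
        { isMagma = record
          { isEquivalence = Setoid.isEquivalence (ℕ →-setoid ℕ)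
          ; ∙-cong        = ⊛-cong
          }
        ; assoc = ⊛-assoc
        }
      ; identityˡ = ⊛-identityˡ
      ; comm      = ⊛-comm
      }
    }

  open CommutativeMonoid ⊛-commutativeMonoid using (identityʳ)
  open import Algebra.Properties.CommutativeMonoid.Mult ⊛-commutativeMonoid
    using (_×_; ×-congʳ; ×-assocˡ; ×-distrib-+; ×-idem)

  ^ₛ≡× : ∀ f j → f ^ₛ j ≡ j × f
  ^ₛ≡× f zero    = refl
  ^ₛ≡× f (suc j) = cong (f ⊛_) (^ₛ≡× f j)

  ^ₛ-cong : ∀ {f g} j → f ≗ g → f ^ₛ j ≗ g ^ₛ j
  ^ₛ-cong {f} {g} j f≗g rewrite ^ₛ≡× f j | ^ₛ≡× g j = ×-congʳ j f≗g

  ^ₛ-* : ∀ f i j → f ^ₛ (i * j) ≗ (f ^ₛ j) ^ₛ i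
  ^ₛ-* f i j rewrite ^ₛ≡× f (i * j) | ^ₛ≡× (f ^ₛ j) i | ^ₛ≡× f j = λ n → sym (×-assocˡ f i j n)

  ^ₛ-distrib-⊛ : ∀ f g j → (f ⊛ g) ^ₛ j ≗ (f ^ₛ j) ⊛ (g ^ₛ j)
  ^ₛ-distrib-⊛ f g j rewrite ^ₛ≡× (f ⊛ g) j | ^ₛ≡× f j | ^ₛ≡× g j = ×-distrib-+ f g j

  𝟙-^ₛ : ∀ j .{{_ : NonZero j}} → 𝟙 ^ₛ j ≗ 𝟙
  𝟙-^ₛ j rewrite ^ₛ≡× 𝟙 j = ×-idem (⊛-identityˡ 𝟙) j

  infix 4 _≈[_]_

  _≈[_]_ : Series → ℕ → Series → Set
  f ≈[ d ] g = ∀ {i} → i < d → f i ≡ g i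

  ≈[]-refl : ∀ {f d} → f ≈[ d ] f
  ≈[]-refl _ = refl

  ≈[]-sym : ∀ {f g d} → f ≈[ d ] g → g ≈[ d ] f
  ≈[]-sym f≈g i<d = sym (f≈g i<d)

  ≈[]-trans : ∀ {f g h d} → f ≈[ d ] g → g ≈[ d ] h → f ≈[ d ] h
  ≈[]-trans f≈g g≈h i<d = trans (f≈g i<d) (g≈h i<d)

  ≈[]-weaken : ∀ {f g d e} → e ≤ d → f ≈[ d ] g → f ≈[ e ] g
  ≈[]-weaken e≤d f≈g i<e = f≈g (<-≤-trans i<e e≤d)

  ⊛-cong-≈[] : ∀ {f f′ g g′ d} → f ≈[ d ] f′ → g ≈[ d ] g′ → f ⊛ g ≈[ d ] f′ ⊛ g′
  ⊛-cong-≈[] {f} {f′} {g} {g′} f≈f′ g≈g′ {zero} 0<d = begin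
    (f ⊛ g) 0      ≡⟨ ⊛-zero f g ⟩
    f 0 * g 0      ≡⟨ cong₂ _*_ (f≈f′ 0<d) (g≈g′ 0<d) ⟩
    f′ 0 * g′ 0    ≡⟨ ⊛-zero f′ g′ ⟨
    (f′ ⊛ g′) 0    ∎
    where open ≡-Reasoning
  ⊛-cong-≈[] {f} {f′} {g} {g′} {suc d} f≈f′ g≈g′ {suc i} (s≤s i<d) = begin
    (f ⊛ g) (suc i)                          ≡⟨ ⊛-suc f g i ⟩
    f 0 * g (suc i) + (tail f ⊛ g) i
      ≡⟨ cong₂ _+_ (cong₂ _*_ (f≈f′ z<s) (g≈g′ (s≤s i<d)))
                   (⊛-cong-≈[] (λ j<d → f≈f′ (s≤s j<d)) (≈[]-weaken (n≤1+n d) g≈g′) i<d) ⟩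
    f′ 0 * g′ (suc i) + (tail f′ ⊛ g′) i     ≡⟨ ⊛-suc f′ g′ i ⟨
    (f′ ⊛ g′) (suc i)                        ∎
    where open ≡-Reasoning

  ^ₛ-cong-≈[] : ∀ {f g d} j → f ≈[ d ] g → f ^ₛ j ≈[ d ] g ^ₛ j
  ^ₛ-cong-≈[] zero    f≈g i<d = refl
  ^ₛ-cong-≈[] (suc j) f≈g     = ⊛-cong-≈[] f≈g (^ₛ-cong-≈[] j f≈g)

  ^ₛ-≈[]-𝟙 : ∀ {f d} j → f ≈[ d ] 𝟙 → f ^ₛ j ≈[ d ] 𝟙
  ^ₛ-≈[]-𝟙 zero    f≈𝟙     = λ _ → refl
  ^ₛ-≈[]-𝟙 (suc j) f≈𝟙 i<d = trans (⊛-cong-≈[] f≈𝟙 (^ₛ-≈[]-𝟙 j f≈𝟙) i<d) (⊛-identityˡ 𝟙 _)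

  shift : ℕ → Series → Series
  shift d f i = f (d + i)

  ⊛-shiftˡ : ∀ {f d} g → f ≈[ d ] 𝟘 → ∀ x → (f ⊛ g) (d + x) ≡ (shift d f ⊛ g) x
  ⊛-shiftˡ {d = zero}      g f≈𝟘 x = refl
  ⊛-shiftˡ {f} {d = suc d} g f≈𝟘 x = begin
    (f ⊛ g) (suc d + x)                       ≡⟨ ⊛-suc f g (d + x) ⟩
    f 0 * g (suc d + x) + (tail f ⊛ g) (d + x) ≡⟨ cong₂ (λ a b → a * g (suc d + x) + b) (f≈𝟘 z<s)
                                                       (⊛-shiftˡ g (λ i<d → f≈𝟘 (s≤s i<d)) x) ⟩
    (shift (suc d) f ⊛ g) x                    ∎
    where open ≡-Reasoning

  record Sparse (m : ℕ) (f : Series) : Set where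
    constructor sparse
    field vanishes : ∀ q {j} → 0 < j → j < m → f (q * m + j) ≡ 0

  open Sparse

  section : ℕ → Series → Series
  section m f n = f (n * m)

  sparse-tail : ∀ {d f} → Sparse (suc d) f → tail f ≈[ d ] 𝟘
  sparse-tail f-sparse i<d = vanishes f-sparse 0 z<s (s≤s i<d)

  sparse-⊛-low : ∀ {d f} g → Sparse (suc d) f → ∀ {i} → i < suc d → (f ⊛ g) i ≡ f 0 * g i
  sparse-⊛-low {f = f} g f-sparse {zero}  _ = ⊛-zero f g
  sparse-⊛-low {f = f} g f-sparse {suc i} (s≤s i<d) = begin
    (f ⊛ g) (suc i)                   ≡⟨ ⊛-suc f g i ⟩
    f 0 * g (suc i) + (tail f ⊛ g) i  ≡⟨ cong (f 0 * g (suc i) +_) tail-f⊛g≡𝟘⊛g ⟩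
    f 0 * g (suc i) + (𝟘 ⊛ g) i       ≡⟨ cong (f 0 * g (suc i) +_) (⊛-zeroˡ g i) ⟩
    f 0 * g (suc i) + 0               ≡⟨ +-identityʳ _ ⟩
    f 0 * g (suc i)                   ∎
    where
    open ≡-Reasoning
    tail-f⊛g≡𝟘⊛g : (tail f ⊛ g) i ≡ (𝟘 ⊛ g) i
    tail-f⊛g≡𝟘⊛g = ⊛-cong-≈[] (sparse-tail f-sparse) (≈[]-refl {g}) i<d

  sparse-⊛-shift : ∀ {d f} g → Sparse (suc d) f → ∀ x →
                   (f ⊛ g) (suc d + x) ≡ f 0 * g (suc d + x) + (shift (suc d) f ⊛ g) x
  sparse-⊛-shift {d} {f} g f-sparse x =
    trans (⊛-suc f g (d + x)) (cong (f 0 * g (suc d + x) +_) (⊛-shiftˡ g (sparse-tail f-sparse) x))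

  shift-sparse : ∀ {m f} → Sparse m f → Sparse m (shift m f)
  shift-sparse {m} {f} f-sparse = sparse λ q {j} 0<j j<m →
    trans (cong f (sym (+-assoc m (q * m) j))) (vanishes f-sparse (suc q) 0<j j<m)

  ⊛-sparse : ∀ {d f g} → Sparse (suc d) f → Sparse (suc d) g → Sparse (suc d) (f ⊛ g)
  ⊛-sparse f-sparse g-sparse = sparse (⊛-vanishes f-sparse g-sparse)
    where
    ⊛-vanishes : ∀ {d f g} → Sparse (suc d) f → Sparse (suc d) g →
                 ∀ q {j} → 0 < j → j < suc d → (f ⊛ g) (q * suc d + j) ≡ 0
    ⊛-vanishes {f = f} {g} f-sparse g-sparse zero {j} 0<j j<m =
      trans (sparse-⊛-low g f-sparse j<m) (trans (cong (f 0 *_) (vanishes g-sparse 0 0<j j<m)) (*-zeroʳ (f 0)))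
    ⊛-vanishes {d} {f} {g} f-sparse g-sparse (suc q) {j} 0<j j<m = begin
      (f ⊛ g) (m + q * m + j)                             ≡⟨ cong (f ⊛ g) (+-assoc m (q * m) j) ⟩
      (f ⊛ g) (m + (q * m + j))                           ≡⟨ sparse-⊛-shift g f-sparse (q * m + j) ⟩
      f 0 * g (m + (q * m + j)) + (shift m f ⊛ g) (q * m + j)
        ≡⟨ cong₂ (λ a b → f 0 * a + b)
                 (trans (cong g (sym (+-assoc m (q * m) j))) (vanishes g-sparse (suc q) 0<j j<m))
                 (⊛-vanishes (shift-sparse f-sparse) g-sparse q 0<j j<m) ⟩
      f 0 * 0 + 0                                          ≡⟨ trans (+-identityʳ _) (*-zeroʳ (f 0)) ⟩
      0                                                    ∎
      where
      open ≡-Reasoning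
      m = suc d

  section-⊛ : ∀ {d f} g → Sparse (suc d) f →
              section (suc d) (f ⊛ g) ≗ section (suc d) f ⊛ section (suc d) g
  section-⊛ {d} {f} g f-sparse zero = trans (⊛-zero f g) (sym (⊛-zero (section (suc d) f) (section (suc d) g)))
  section-⊛ {d} {f} g f-sparse (suc n) = begin
    (f ⊛ g) (m + n * m)                                      ≡⟨ sparse-⊛-shift g f-sparse (n * m) ⟩
    f 0 * g (m + n * m) + (shift m f ⊛ g) (n * m)
      ≡⟨ cong (f 0 * g (m + n * m) +_) (section-⊛ g (shift-sparse f-sparse) n) ⟩
    f 0 * g (m + n * m) + (tail (section m f) ⊛ section m g) n ≡⟨ ⊛-suc (section m f) (section m g) n ⟨
    (section m f ⊛ section m g) (suc n)                      ∎
    where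
    open ≡-Reasoning
    m = suc d

  𝟙-sparse : ∀ {m} → Sparse m 𝟙
  𝟙-sparse {m} = sparse λ { q {suc j} _ _ → cong 𝟙 (+-suc (q * m) j) }

  ^ₛ-sparse : ∀ {d f} j → Sparse (suc d) f → Sparse (suc d) (f ^ₛ j)
  ^ₛ-sparse zero    f-sparse = 𝟙-sparse
  ^ₛ-sparse (suc j) f-sparse = ⊛-sparse f-sparse (^ₛ-sparse j f-sparse)

  section-𝟙 : ∀ {d} → section (suc d) 𝟙 ≗ 𝟙
  section-𝟙 zero    = refl
  section-𝟙 (suc n) = refl

  section-^ₛ : ∀ {d f} j → Sparse (suc d) f → section (suc d) (f ^ₛ j) ≗ section (suc d) f ^ₛ j
  section-^ₛ zero    f-sparse = section-𝟙
  section-^ₛ {f = f} (suc j) f-sparse n =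
    trans (section-⊛ {f = f} (f ^ₛ j) f-sparse n)
          (⊛-cong {f = section _ f} (λ _ → refl) (section-^ₛ {f = f} j f-sparse) n)

  indicator : Bool → ℕ
  indicator b = if b then 1 else 0

  1+q^-vanishes : ∀ {d n} → n ≢ 0 → n ≢ d → 1+q^ d n ≡ 0
  1+q^-vanishes {d} {n} n≢0 n≢d =
    cong₂ _+_ (cong indicator (dec-false (n ≟ 0) n≢0)) (cong indicator (dec-false (n ≟ d) n≢d))

  1+q^-≈[]-𝟙 : ∀ d → 1+q^ d ≈[ d ] 𝟙
  1+q^-≈[]-𝟙 (suc d) {zero}  _   = refl
  1+q^-≈[]-𝟙 (suc d) {suc i} i<d = 1+q^-vanishes (λ ()) (λ i≡d → <-irrefl i≡d i<d)

  offset-∤ : ∀ {m j} q → 0 < j → j < m → ¬ m ∣ q * m + j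
  offset-∤ {m} {j} q 0<j j<m m∣ = >⇒∤ {{>-nonZero 0<j}} j<m (∣m+n∣m⇒∣n m∣ (n∣m*n q))

  1+q^-sparse : ∀ {m} d → Sparse m (1+q^ (m * d))
  1+q^-sparse {m} d = sparse λ q 0<j j<m → 1+q^-vanishes
    (λ e → offset-∤ q 0<j j<m (subst (m ∣_) (sym e) (m ∣0)))
    (λ e → offset-∤ q 0<j j<m (subst (m ∣_) (sym e) (m∣m*n d)))

  section-1+q^ : ∀ {m} .{{_ : NonZero m}} d → section m (1+q^ (m * d)) ≗ 1+q^ d
  section-1+q^ {m} d n =
    cong₂ _+_ (cong indicator (≡ᵇ-*-cancelʳ refl)) (cong indicator (≡ᵇ-*-cancelʳ (*-comm m d)))
    where
    ≡ᵇ-*-cancelʳ : ∀ {k l} → l ≡ k * m → (n * m ≡ᵇ l) ≡ (n ≡ᵇ k)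
    ≡ᵇ-*-cancelʳ {k} {l} l≡k*m =
      does-⇔ (mk⇔ (λ e → *-cancelʳ-≡ n k m (trans e l≡k*m)) (λ { refl → sym l≡k*m })) (n * m ≟ l) (n ≟ k)

  n<m^n : ∀ {m} → 1 < m → ∀ n → n < m ^ n
  n<m^n 1<m zero    = z<s
  n<m^n {m} 1<m (suc n) = ≤-<-trans (n<m^n 1<m n) (^-monoʳ-< m 1<m (n<1+n n))

  factor : ℕ → ℕ → Series
  factor m N = 1+q^ (m ^ N) ^ₛ (m ^ N)

  module _ {k : ℕ} where

    private
      m : ℕ
      m = 2 + k

    section-factor : ∀ N → section m (factor m (suc N)) ≗ factor m N ^ₛ m
    section-factor N = begin
      section m (1+q^ (m * d) ^ₛ (m * d))  ≈⟨ section-^ₛ (m * d) (1+q^-sparse d) ⟩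
      section m (1+q^ (m * d)) ^ₛ (m * d)  ≈⟨ ^ₛ-cong (m * d) (section-1+q^ d) ⟩
      1+q^ d ^ₛ (m * d)                    ≈⟨ ^ₛ-* (1+q^ d) m d ⟩
      (1+q^ d ^ₛ d) ^ₛ m                   ∎
      where
      open SetoidReasoning (ℕ →-setoid ℕ)
      d = m ^ N

    section-∏factors : ∀ N → section m (∏factors m (suc N)) ≗ ∏factors m N ^ₛ m
    section-∏factors zero = begin
      section m (𝟙 ⊛ (1+q^ 1 ⊛ 𝟙))
        ≈⟨ (λ n → trans (⊛-identityˡ (1+q^ 1 ⊛ 𝟙) (n * m)) (identityʳ (1+q^ 1) (n * m))) ⟩
      section m (1+q^ 1)
        ≈⟨ (λ { zero → refl ; (suc n) → refl }) ⟩
      𝟙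
        ≈⟨ 𝟙-^ₛ m ⟨
      𝟙 ^ₛ m
        ∎
      where open SetoidReasoning (ℕ →-setoid ℕ)
    section-∏factors (suc N) = begin
      section m (P (suc N) ⊛ factor m (suc N))
        ≈⟨ (λ n → ⊛-comm (P (suc N)) (factor m (suc N)) (n * m)) ⟩
      section m (factor m (suc N) ⊛ P (suc N))
        ≈⟨ section-⊛ (P (suc N)) (^ₛ-sparse (m * m ^ N) (1+q^-sparse (m ^ N))) ⟩
      section m (factor m (suc N)) ⊛ section m (P (suc N))
        ≈⟨ ⊛-cong (section-factor N) (section-∏factors N) ⟩
      (factor m N ^ₛ m) ⊛ (P N ^ₛ m)
        ≈⟨ ⊛-comm (factor m N ^ₛ m) (P N ^ₛ m) ⟩
      (P N ^ₛ m) ⊛ (factor m N ^ₛ m)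
        ≈⟨ ^ₛ-distrib-⊛ (P N) (factor m N) m ⟨
      (P N ⊛ factor m N) ^ₛ m
        ∎
      where
      open SetoidReasoning (ℕ →-setoid ℕ)
      P = ∏factors m

    ∏factors-step : ∀ N → ∏factors m (suc N) ≈[ m ^ N ] ∏factors m N
    ∏factors-step N {i} i<m^N = begin
      (∏factors m N ⊛ factor m N) i  ≡⟨ ⊛-cong-≈[] (≈[]-refl {∏factors m N}) factor≈𝟙 i<m^N ⟩
      (∏factors m N ⊛ 𝟙) i           ≡⟨ identityʳ (∏factors m N) i ⟩
      ∏factors m N i                 ∎
      where
      open ≡-Reasoning
      factor≈𝟙 : factor m N ≈[ m ^ N ] 𝟙
      factor≈𝟙 = ^ₛ-≈[]-𝟙 (m ^ N) (1+q^-≈[]-𝟙 (m ^ N))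

    ∏factors-stable : ∀ e {N} → ∏factors m (e + N) ≈[ N ] ∏factors m N
    ∏factors-stable zero    {N} = ≈[]-refl {∏factors m N}
    ∏factors-stable (suc e) {N} = ≈[]-trans
      (≈[]-weaken (≤-trans (m≤n+m N e) (<⇒≤ (n<m^n (s≤s (s≤s z≤n)) (e + N)))) (∏factors-step (e + N)))
      (∏factors-stable e)

    a≈[]∏factors : ∀ N → a m ≈[ N ] ∏factors m N
    a≈[]∏factors N {i} i<N = sym (subst (λ M → ∏factors m M i ≡ a m i) (m∸n+n≡m i<N)
                                    (∏factors-stable (N ∸ suc i) (n<1+n i)))

    a-convolutive : ∀ n → a m (m * n) ≡ (a m ^ₛ m) n
    a-convolutive n = begin
      a m (m * n)                      ≡⟨ a≈[]∏factors (suc N) (m<n⇒m<1+n (n<1+n (m * n))) ⟩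
      ∏factors m (suc N) (m * n)       ≡⟨ cong (∏factors m (suc N)) (*-comm m n) ⟩
      section m (∏factors m (suc N)) n ≡⟨ section-∏factors N n ⟩
      (∏factors m N ^ₛ m) n            ≡⟨ ^ₛ-cong-≈[] m (≈[]-sym (a≈[]∏factors N)) (s≤s (m≤n*m n m)) ⟩
      (a m ^ₛ m) n                     ∎
      where
      open ≡-Reasoning
      N = suc (m * n)

module Partitions where

  open import Level using (0ℓ)
  open import Data.Nat as ℕ using (ℕ; zero; suc; _+_; _*_; _^_; _<_; s≤s; z<s; NonZero)
  import Data.Nat.Properties as ℕ
  open import Algebra.Properties.CommutativeSemigroup ℕ.+-commutativeSemigroup
    using () renaming (interchange to +-interchange)
  open import Data.Nat.Divisibility using (_∣_; _∣0; divides; ∣m∣n⇒∣m+n; m∣m*n; ∣m+n∣m⇒∣n; ∣1⇒≡1)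
  open import Data.Fin as Fin using (Fin; toℕ; combine; remQuot)
  import Data.Fin.Properties as Fin
  open import Data.Bool using (if_then_else_)
  open import Data.Maybe using (Maybe; just; nothing; maybe)
  open import Data.Maybe.Properties using (just-injective)
  open import Data.List using (List; []; _∷_; map; mapMaybe; foldr; concatMap; allFin; length)
  open import Data.Nat.ListAction using (sum)
  open import Data.List.Relation.Unary.All as All using (All; []; _∷_)
  open import Data.List.Relation.Unary.AllPairs using (AllPairs; []; _∷_)
  open import Data.List.Relation.Unary.Any using (here; there)
  open import Data.List.Relation.Unary.Linked as Linked using (Linked)
  open import Data.List.Relation.Unary.Linked.Properties using (AllPairs⇒Linked; Linked⇒AllPairs)
  open import Data.List.Membership.Propositional using (_∈_; _∉_; lose; find)
  open import Data.List.Membership.Propositional.Properties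
    using (∈-map⁺; ∈-map⁻; ∈-concatMap⁺; ∈-concatMap⁻; ∈-allFin)
  open import Data.List.Relation.Binary.Subset.Propositional using (_⊆_)
  open import Data.Vec as Vec using (Vec; tabulate; lookup)
  import Data.Vec.Properties as Vec
  open import Data.Product using (∃; ∃₂; _×_; _,_; proj₁; proj₂; uncurry)
  open import Data.Sum using (_⊎_; inj₁; inj₂)
  open import Data.Empty using (⊥-elim)
  open import Function using (_∘_; _↔_; mk↔ₛ′)
  open import Relation.Binary
    using (Rel; IsStrictTotalOrder; Trichotomous; Tri; tri<; tri≈; tri>; Irrelevant; Transitive)
  open import Relation.Binary.Structures.Biased using (isStrictTotalOrderᶜ)
  open import Relation.Binary.PropositionalEquality
  open import Relation.Nullary using (¬_; does; yes; no; contradiction)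
  open import Relation.Nullary.Decidable using (dec-true; dec-false)

  module _ {A B : Set} (f : A → Maybe B) where

    ∈-mapMaybe⁺ : ∀ {x y} xs → x ∈ xs → f x ≡ just y → y ∈ mapMaybe f xs
    ∈-mapMaybe⁺ (x ∷ xs) (here refl) fx≡y rewrite fx≡y = here refl
    ∈-mapMaybe⁺ (z ∷ xs) (there x∈xs) fx≡y with f z
    ... | nothing = ∈-mapMaybe⁺ xs x∈xs fx≡y
    ... | just _  = there (∈-mapMaybe⁺ xs x∈xs fx≡y)

    private
      in-tail : ∀ {y z xs} → ∃ (λ x → x ∈ xs × f x ≡ just y) → ∃ λ x → x ∈ z ∷ xs × f x ≡ just y
      in-tail (x , x∈ , fx≡) = x , there x∈ , fx≡

    ∈-mapMaybe⁻ : ∀ {y} xs → y ∈ mapMaybe f xs → ∃ λ x → x ∈ xs × f x ≡ just y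
    ∈-mapMaybe⁻ (x ∷ xs) y∈ with f x in fx≡
    ∈-mapMaybe⁻ (x ∷ xs) y∈           | nothing = in-tail (∈-mapMaybe⁻ xs y∈)
    ∈-mapMaybe⁻ (x ∷ xs) (here refl)  | just _  = x , here refl , fx≡
    ∈-mapMaybe⁻ (x ∷ xs) (there y∈)   | just _  = in-tail (∈-mapMaybe⁻ xs y∈)

    AllPairs-mapMaybe⁺ : ∀ {R : Rel A 0ℓ} {S : Rel B 0ℓ} →
      (∀ {x y x′ y′} → f x ≡ just x′ → f y ≡ just y′ → R x y → S x′ y′) →
      ∀ {xs} → AllPairs R xs → AllPairs S (mapMaybe f xs)
    AllPairs-mapMaybe⁺ mono [] = []
    AllPairs-mapMaybe⁺ {S = S} mono {x ∷ xs} (x<xs ∷ xs-sorted) with f x in fx≡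
    ... | nothing = AllPairs-mapMaybe⁺ mono xs-sorted
    ... | just x′ = All.tabulate x′<y′ ∷ AllPairs-mapMaybe⁺ mono xs-sorted
      where
      x′<y′ : ∀ {y′} → y′ ∈ mapMaybe f xs → S x′ y′
      x′<y′ y′∈ = let y , y∈ , fy≡ = ∈-mapMaybe⁻ xs y′∈ in mono fx≡ fy≡ (All.lookup x<xs y∈)

    sum-mapMaybe-∷ : ∀ (g : B → ℕ) x xs →
      sum (map g (mapMaybe f (x ∷ xs))) ≡ maybe g 0 (f x) + sum (map g (mapMaybe f xs))
    sum-mapMaybe-∷ g x xs with f x
    ... | nothing = refl
    ... | just _  = refl

  length≡sum-map-1 : ∀ {A : Set} (xs : List A) → length xs ≡ sum (map (λ _ → 1) xs)
  length≡sum-map-1 []       = refl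
  length≡sum-map-1 (x ∷ xs) = cong suc (length≡sum-map-1 xs)

  sum-tabulate-+ : ∀ {n} (f g : Fin n → ℕ) →
                   Vec.sum (tabulate (λ j → f j + g j)) ≡ Vec.sum (tabulate f) + Vec.sum (tabulate g)
  sum-tabulate-+ {zero}  f g = refl
  sum-tabulate-+ {suc n} f g =
    trans (cong (f Fin.zero + g Fin.zero +_) (sum-tabulate-+ (f ∘ Fin.suc) (g ∘ Fin.suc)))
          (+-interchange (f Fin.zero) (g Fin.zero) _ _)

  sum-tabulate-zero : ∀ {n} (f : Fin n → ℕ) → (∀ j → f j ≡ 0) → Vec.sum (tabulate f) ≡ 0
  sum-tabulate-zero {zero}  f f≡0 = refl
  sum-tabulate-zero {suc n} f f≡0 =
    cong₂ _+_ (f≡0 Fin.zero) (sum-tabulate-zero (f ∘ Fin.suc) (f≡0 ∘ Fin.suc))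

  sum-tabulate-single : ∀ {n} (f : Fin n → ℕ) i → (∀ j → i ≢ j → f j ≡ 0) → Vec.sum (tabulate f) ≡ f i
  sum-tabulate-single f Fin.zero    f≡0 =
    trans (cong (f Fin.zero +_) (sum-tabulate-zero (f ∘ Fin.suc) (λ j → f≡0 (Fin.suc j) λ ()))) (ℕ.+-identityʳ _)
  sum-tabulate-single f (Fin.suc i) f≡0 =
    trans (cong (_+ Vec.sum (tabulate (f ∘ Fin.suc))) (f≡0 Fin.zero λ ()))
          (sum-tabulate-single (f ∘ Fin.suc) i (λ j i≢j → f≡0 (Fin.suc j) (i≢j ∘ Fin.suc-injective)))

  module StrictlySortedLists {A : Set} {_<_ : Rel A 0ℓ} (sto : IsStrictTotalOrder _≡_ _<_) where

    open IsStrictTotalOrder sto using (irrefl; asym; compare) renaming (trans to <-trans)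

    Sorted : List A → Set
    Sorted = AllPairs _<_

    private
      head-∉-tail : ∀ {x xs} → All (x <_) xs → x ∉ xs
      head-∉-tail x<xs x∈xs = irrefl refl (All.lookup x<xs x∈xs)

      tail-⊆ : ∀ {x y xs ys} → All (x <_) xs → x ≡ y → x ∷ xs ⊆ y ∷ ys → xs ⊆ ys
      tail-⊆ x<xs refl xs⊆ z∈xs with xs⊆ (there z∈xs)
      ... | here refl = ⊥-elim (head-∉-tail x<xs z∈xs)
      ... | there z∈ys = z∈ys

    sorted-≡ : ∀ {xs ys} → Sorted xs → Sorted ys → xs ⊆ ys → ys ⊆ xs → xs ≡ ys
    sorted-≡ [] [] _ _ = refl
    sorted-≡ [] (_ ∷ _) _ ys⊆xs with ys⊆xs (here refl)
    ... | ()
    sorted-≡ (_ ∷ _) [] xs⊆ys _ with xs⊆ys (here refl)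
    ... | ()
    sorted-≡ {x ∷ xs} {y ∷ ys} (x<xs ∷ xs-sorted) (y<ys ∷ ys-sorted) xs⊆ys ys⊆xs =
      cong₂ _∷_ x≡y (sorted-≡ xs-sorted ys-sorted (tail-⊆ x<xs x≡y xs⊆ys) (tail-⊆ y<ys (sym x≡y) ys⊆xs))
      where
      x≡y : x ≡ y
      x≡y with xs⊆ys (here refl) | ys⊆xs (here refl)
      ... | here x≡y   | _          = x≡y
      ... | there _    | here y≡x   = sym y≡x
      ... | there x∈ys | there y∈xs = ⊥-elim (asym (All.lookup x<xs y∈xs) (All.lookup y<ys x∈ys))

    insert : A → List A → List A
    insert x [] = x ∷ []
    insert x (y ∷ ys) with compare x y
    ... | tri< _ _ _ = x ∷ y ∷ ys
    ... | tri≈ _ _ _ = y ∷ ys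
    ... | tri> _ _ _ = y ∷ insert x ys

    ∈-insert⁺ : ∀ {x z} ys → z ≡ x ⊎ z ∈ ys → z ∈ insert x ys
    ∈-insert⁺ [] (inj₁ refl) = here refl
    ∈-insert⁺ {x} (y ∷ ys) z∈ with compare x y | z∈
    ... | tri< _ _ _ | inj₁ refl          = here refl
    ... | tri< _ _ _ | inj₂ z∈ys          = there z∈ys
    ... | tri≈ _ x≡y _ | inj₁ refl        = here x≡y
    ... | tri≈ _ _ _ | inj₂ z∈ys          = z∈ys
    ... | tri> _ _ _ | inj₁ refl          = there (∈-insert⁺ ys (inj₁ refl))
    ... | tri> _ _ _ | inj₂ (here z≡y)    = here z≡y
    ... | tri> _ _ _ | inj₂ (there z∈ys)  = there (∈-insert⁺ ys (inj₂ z∈ys))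

    ∈-insert⁻ : ∀ {x z} ys → z ∈ insert x ys → z ≡ x ⊎ z ∈ ys
    ∈-insert⁻ [] (here z≡x) = inj₁ z≡x
    ∈-insert⁻ {x} (y ∷ ys) z∈ with compare x y | z∈
    ... | tri< _ _ _ | here z≡x   = inj₁ z≡x
    ... | tri< _ _ _ | there z∈ys = inj₂ z∈ys
    ... | tri≈ _ _ _ | z∈ys       = inj₂ z∈ys
    ... | tri> _ _ _ | here z≡y   = inj₂ (here z≡y)
    ... | tri> _ _ _ | there z∈′  with ∈-insert⁻ ys z∈′
    ...   | inj₁ z≡x  = inj₁ z≡x
    ...   | inj₂ z∈ys = inj₂ (there z∈ys)

    insert-sorted : ∀ x {ys} → Sorted ys → Sorted (insert x ys)
    insert-sorted x [] = [] ∷ []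
    insert-sorted x {y ∷ ys} (y<ys ∷ ys-sorted) with compare x y
    ... | tri< x<y _ _ = (x<y ∷ All.map (<-trans x<y) y<ys) ∷ y<ys ∷ ys-sorted
    ... | tri≈ _ _ _   = y<ys ∷ ys-sorted
    ... | tri> _ _ y<x = All.tabulate y<insert ∷ insert-sorted x ys-sorted
      where
      y<insert : ∀ {z} → z ∈ insert x ys → y < z
      y<insert z∈ with ∈-insert⁻ ys z∈
      ... | inj₁ refl = y<x
      ... | inj₂ z∈ys = All.lookup y<ys z∈ys

    fromList : List A → List A
    fromList = foldr insert []

    fromList-sorted : ∀ xs → Sorted (fromList xs)
    fromList-sorted []       = []
    fromList-sorted (x ∷ xs) = insert-sorted x (fromList-sorted xs)

    ⊆-fromList : ∀ xs → xs ⊆ fromList xs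
    ⊆-fromList (x ∷ xs) (here z≡x)  = ∈-insert⁺ (fromList xs) (inj₁ z≡x)
    ⊆-fromList (x ∷ xs) (there z∈xs) = ∈-insert⁺ (fromList xs) (inj₂ (⊆-fromList xs z∈xs))

    fromList-⊆ : ∀ xs → fromList xs ⊆ xs
    fromList-⊆ (x ∷ xs) z∈ with ∈-insert⁻ (fromList xs) z∈
    ... | inj₁ z≡x = here z≡x
    ... | inj₂ z∈  = there (fromList-⊆ xs z∈)

  module _ {m : ℕ} where

    <ₚ-irrefl : ∀ {p : Part m} → ¬ p <ₚ p
    <ₚ-irrefl (inj₁ k<k)       = ℕ.<-irrefl refl k<k
    <ₚ-irrefl (inj₂ (_ , c<c)) = ℕ.<-irrefl refl c<c

    <ₚ-trans : Transitive (_<ₚ_ {m})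
    <ₚ-trans (inj₁ k<k′)        (inj₁ k′<k″)        = inj₁ (ℕ.<-trans k<k′ k′<k″)
    <ₚ-trans (inj₁ k<k′)        (inj₂ (refl , _))   = inj₁ k<k′
    <ₚ-trans (inj₂ (refl , _))  (inj₁ k′<k″)        = inj₁ k′<k″
    <ₚ-trans (inj₂ (refl , c<c′)) (inj₂ (refl , c′<c″)) = inj₂ (refl , ℕ.<-trans c<c′ c′<c″)

    private
      tri<′ : ∀ {p q} → p <ₚ q → Tri (p <ₚ q) (p ≡ q) (q <ₚ p)
      tri<′ p<q = tri< p<q (λ { refl → <ₚ-irrefl p<q }) (λ q<p → <ₚ-irrefl (<ₚ-trans p<q q<p))
      tri>′ : ∀ {p q} → q <ₚ p → Tri (p <ₚ q) (p ≡ q) (q <ₚ p)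
      tri>′ q<p = tri> (λ p<q → <ₚ-irrefl (<ₚ-trans p<q q<p)) (λ { refl → <ₚ-irrefl q<p }) q<p

    <ₚ-cmp : Trichotomous _≡_ (_<ₚ_ {m})
    <ₚ-cmp (k , c) (k′ , c′) with ℕ.<-cmp k k′
    ... | tri< k<k′ _ _ = tri<′ (inj₁ k<k′)
    ... | tri> _ _ k>k′ = tri>′ (inj₁ k>k′)
    ... | tri≈ _ refl _ with Fin.<-cmp c c′
    ...   | tri< c<c′ _ _ = tri<′ (inj₂ (refl , c<c′))
    ...   | tri≈ _ refl _ = tri≈ <ₚ-irrefl refl <ₚ-irrefl
    ...   | tri> _ _ c>c′ = tri>′ (inj₂ (refl , c>c′))

    <ₚ-irrelevant : Irrelevant (_<ₚ_ {m})
    <ₚ-irrelevant (inj₁ k<k′) (inj₁ k<k′′) = cong inj₁ (ℕ.<-irrelevant k<k′ k<k′′)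
    <ₚ-irrelevant (inj₁ k<k) (inj₂ (refl , _)) = ⊥-elim (ℕ.<-irrefl refl k<k)
    <ₚ-irrelevant (inj₂ (refl , _)) (inj₁ k<k) = ⊥-elim (ℕ.<-irrefl refl k<k)
    <ₚ-irrelevant (inj₂ (k≡k′ , c<c′)) (inj₂ (k≡k′′ , c<c′′)) =
      cong₂ (λ e c<c → inj₂ (e , c<c)) (ℕ.≡-irrelevant k≡k′ k≡k′′) (ℕ.<-irrelevant c<c′ c<c′′)

    <ₚ-isStrictTotalOrder : IsStrictTotalOrder _≡_ (_<ₚ_ {m})
    <ₚ-isStrictTotalOrder = isStrictTotalOrderᶜ record
      { isEquivalence = isEquivalence
      ; trans         = <ₚ-trans
      ; compare       = <ₚ-cmp
      }

    open StrictlySortedLists <ₚ-isStrictTotalOrder public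

    𝒜-≡ : {π π′ : 𝒜 m} → proj₁ π ≡ proj₁ π′ → π ≡ π′
    𝒜-≡ {xs , xs-linked} {.xs , xs-linked′} refl =
      cong (xs ,_) (Linked.irrelevant <ₚ-irrelevant xs-linked xs-linked′)

    sorted : (π : 𝒜 m) → Sorted (proj₁ π)
    sorted (_ , xs-linked) = Linked⇒AllPairs <ₚ-trans xs-linked

    lift : Fin m → Part m → Part m
    lift j (e , c) = suc e , combine j c

    private
      select : Fin m → (e : ℕ) → Fin m × Fin (m ^ e) → Maybe (Part m)
      select j e (i , c) = if does (i Fin.≟ j) then just (e , c) else nothing

    lower : Fin m → Part m → Maybe (Part m)
    lower j (zero  , c) = nothing
    lower j (suc e , c) = select j e (remQuot (m ^ e) c)

    lower-lift : ∀ j p → lower j (lift j p) ≡ just p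
    lower-lift j (e , c) = trans (cong (select j e) (Fin.remQuot-combine j c))
                                 (cong (if_then just (e , c) else nothing) (dec-true (j Fin.≟ j) refl))

    lower-lift-≢ : ∀ {i j} p → i ≢ j → lower j (lift i p) ≡ nothing
    lower-lift-≢ {i} {j} (e , c) i≢j = trans (cong (select j e) (Fin.remQuot-combine i c))
                                             (cong (if_then just (e , c) else nothing) (dec-false (i Fin.≟ j) i≢j))

    lift-lower : ∀ {j x p} → lower j x ≡ just p → x ≡ lift j p
    lift-lower {j} {suc e , c} {p} lower≡ =
      trans (cong (suc e ,_) (sym (Fin.combine-remQuot {m} (m ^ e) c))) (select-just (remQuot (m ^ e) c) lower≡)
      where
      select-just : ∀ r → select j e r ≡ just p → (suc e , uncurry combine r) ≡ lift j p
      select-just (i , c′) select≡ with i Fin.≟ j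
      select-just (i , c′) refl | yes refl = refl

    lift-injective : ∀ {i j p q} → lift i p ≡ lift j q → i ≡ j × p ≡ q
    lift-injective {i} {j} {p} {q} lift≡ with i Fin.≟ j
    ... | yes refl = refl , just-injective (begin
      just p             ≡⟨ lower-lift i p ⟨
      lower i (lift i p) ≡⟨ cong (lower i) lift≡ ⟩
      lower i (lift i q) ≡⟨ lower-lift i q ⟩
      just q             ∎)
      where open ≡-Reasoning
    ... | no i≢j   = contradiction (begin
      just q             ≡⟨ lower-lift j q ⟨
      lower j (lift j q) ≡⟨ cong (lower j) lift≡ ⟨
      lower j (lift i p) ≡⟨ lower-lift-≢ p i≢j ⟩
      nothing            ∎) λ ()
      where open ≡-Reasoning

    lift-reflects-< : ∀ {j p q} → lift j p <ₚ lift j q → p <ₚ q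
    lift-reflects-< (inj₁ (s≤s e<e′)) = inj₁ e<e′
    lift-reflects-< {j} {e , c} {.e , c′} (inj₂ (refl , lifted<)) = inj₂ (refl ,
      ℕ.+-cancelˡ-< (m ^ e * toℕ j) (toℕ c) (toℕ c′)
        (subst₂ _<_ (Fin.toℕ-combine j c) (Fin.toℕ-combine j c′) lifted<))

    Positive : Part m → Set
    Positive (e , _) = 0 < e

    data Lifted : Part m → Set where
      lifted : ∀ j p → Lifted (lift j p)

    positive⇒lifted : ∀ x → Positive x → Lifted x
    positive⇒lifted (suc e , c) _ =
      subst Lifted (cong (suc e ,_) (Fin.combine-remQuot {m} (m ^ e) c)) (lifted _ (e , _))

    above-positive : ∀ {x y : Part m} → x <ₚ y → Positive y
    above-positive {y = suc _ , _}      _                 = z<s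
    above-positive {y = zero , Fin.zero} (inj₂ (_ , ()))

    split : Fin m → List (Part m) → List (Part m)
    split j = mapMaybe (lower j)

    ∈-split⁺ : ∀ {j p} xs → lift j p ∈ xs → p ∈ split j xs
    ∈-split⁺ {j} {p} xs lift∈ = ∈-mapMaybe⁺ (lower j) xs lift∈ (lower-lift j p)

    ∈-split⁻ : ∀ {j p} xs → p ∈ split j xs → lift j p ∈ xs
    ∈-split⁻ {j} xs p∈ =
      let x , x∈ , lower≡ = ∈-mapMaybe⁻ (lower j) xs p∈ in subst (_∈ xs) (lift-lower lower≡) x∈

    split-sorted : ∀ j {xs} → Sorted xs → Sorted (split j xs)
    split-sorted j = AllPairs-mapMaybe⁺ (lower j) λ lower≡x′ lower≡y′ x<y →
      lift-reflects-< (subst₂ _<ₚ_ (lift-lower lower≡x′) (lift-lower lower≡y′) x<y)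

    unionLifts : Vec (𝒜 m) m → List (Part m)
    unionLifts λs = concatMap (λ j → map (lift j) (proj₁ (lookup λs j))) (allFin m)

    ∈-unionLifts⁺ : ∀ λs j {p} → p ∈ proj₁ (lookup λs j) → lift j p ∈ unionLifts λs
    ∈-unionLifts⁺ λs j p∈ =
      ∈-concatMap⁺ (λ i → map (lift i) (proj₁ (lookup λs i))) {allFin m} (lose (∈-allFin j) (∈-map⁺ (lift j) p∈))

    ∈-unionLifts⁻ : ∀ λs {q} → q ∈ unionLifts λs →
                    ∃₂ λ j p → p ∈ proj₁ (lookup λs j) × q ≡ lift j p
    ∈-unionLifts⁻ λs q∈ with find (∈-concatMap⁻ (λ j → map (lift j) (proj₁ (lookup λs j))) {allFin m} q∈)
    ... | j , _ , q∈map = let p , p∈ , q≡ = ∈-map⁻ (lift j) q∈map in j , p , p∈ , q≡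

    splitSum : (Part m → ℕ) → List (Part m) → ℕ
    splitSum G xs = Vec.sum (tabulate λ j → sum (map G (split j xs)))

    sum≡splitSum : ∀ (G H : Part m → ℕ) c → (∀ j p → H (lift j p) ≡ c * G p) →
                ∀ {xs} → All Positive xs → sum (map H xs) ≡ c * splitSum G xs
    sum≡splitSum G H c H≡cG [] = sym (trans (cong (c *_) (sum-tabulate-zero {m} _ λ _ → refl)) (ℕ.*-zeroʳ c))
    sum≡splitSum G H c H≡cG {x ∷ xs} (x-pos ∷ xs-pos) with positive⇒lifted x x-pos
    ... | lifted i p = begin
      H (lift i p) + sum (map H xs)
        ≡⟨ cong₂ _+_ (H≡cG i p) (sum≡splitSum G H c H≡cG xs-pos) ⟩
      c * G p + c * splitSum G xs
        ≡⟨ ℕ.*-distribˡ-+ c (G p) _ ⟨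
      c * (G p + splitSum G xs)
        ≡⟨ cong (λ s → c * (s + splitSum G xs))
                (trans (sum-tabulate-single Gx i only-i) (cong (maybe G 0) (lower-lift i p))) ⟨
      c * (Vec.sum (tabulate Gx) + splitSum G xs)
        ≡⟨ cong (c *_) (sum-tabulate-+ Gx (λ j → sum (map G (split j xs)))) ⟨
      c * Vec.sum (tabulate (λ j → Gx j + sum (map G (split j xs))))
        ≡⟨ cong (λ v → c * Vec.sum v) (Vec.tabulate-cong λ j → sum-mapMaybe-∷ (lower j) G (lift i p) xs) ⟨
      c * splitSum G (lift i p ∷ xs)
        ∎
      where
      open ≡-Reasoning
      Gx : Fin m → ℕ
      Gx j = maybe G 0 (lower j (lift i p))
      only-i : ∀ j → i ≢ j → Gx j ≡ 0
      only-i j i≢j = cong (maybe G 0) (lower-lift-≢ p i≢j)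

    positive⇒∣ : ∀ {xs} → All Positive xs → m ∣ sum (map size xs)
    positive⇒∣ []                                = m ∣0
    positive⇒∣ {(suc e , _) ∷ xs} (_ ∷ xs-pos) = ∣m∣n⇒∣m+n (m∣m*n (m ^ e)) (positive⇒∣ xs-pos)

    ∣⇒positive : m ≢ 1 → ∀ {xs} → Sorted xs → m ∣ sum (map size xs) → All Positive xs
    ∣⇒positive m≢1 []                                 _   = []
    ∣⇒positive m≢1 {(suc e , c) ∷ xs} (x<xs ∷ _) _   = z<s ∷ All.map above-positive x<xs
    ∣⇒positive m≢1 {(zero  , c) ∷ xs} (x<xs ∷ _) m∣ = contradiction (∣1⇒≡1 m∣1) m≢1
      where
      m∣1 : m ∣ 1
      m∣1 = ∣m+n∣m⇒∣n (subst (m ∣_) (ℕ.+-comm 1 _) m∣) (positive⇒∣ (All.map above-positive x<xs))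

    ∣-irrelevant : .{{_ : NonZero m}} → ∀ {n} (m∣n m∣n′ : m ∣ n) → m∣n ≡ m∣n′
    ∣-irrelevant (divides q n≡qm) (divides q′ n≡q′m)
      with ℕ.*-cancelʳ-≡ q q′ m (trans (sym n≡qm) n≡q′m)
    ... | refl = cong (divides q) (ℕ.≡-irrelevant n≡qm n≡q′m)

    [𝒜]ₘ-≡ : .{{_ : NonZero m}} → {π π′ : [𝒜]ₘ m} → proj₁ (proj₁ π) ≡ proj₁ (proj₁ π′) → π ≡ π′
    [𝒜]ₘ-≡ {π , m∣} {π′ , m∣′} xs≡ with 𝒜-≡ {π} {π′} xs≡
    ... | refl = cong (π ,_) (∣-irrelevant m∣ m∣′)

    split𝒜 : Fin m → 𝒜 m → 𝒜 m
    split𝒜 j π = split j (proj₁ π) , AllPairs⇒Linked (split-sorted j (sorted π))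

    fromList𝒜 : List (Part m) → 𝒜 m
    fromList𝒜 xs = fromList xs , AllPairs⇒Linked (fromList-sorted xs)

  module _ {k : ℕ} where

    private
      m : ℕ
      m = 2 + k

    splitₘ : [𝒜]ₘ m → Vec (𝒜 m) m
    splitₘ (π , _) = tabulate λ j → split𝒜 j π

    mergeₘ : Vec (𝒜 m) m → [𝒜]ₘ m
    mergeₘ λs = fromList𝒜 (unionLifts λs) , positive⇒∣ merged-positive
      where
      merged-positive : All Positive (fromList (unionLifts λs))
      merged-positive = All.tabulate λ q∈ →
        let _ , _ , _ , q≡lift = ∈-unionLifts⁻ λs (fromList-⊆ (unionLifts λs) q∈)
        in subst Positive (sym q≡lift) z<s

    splitₘ∘mergeₘ : ∀ λs → splitₘ (mergeₘ λs) ≡ λs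
    splitₘ∘mergeₘ λs =
      trans (Vec.tabulate-cong λ j → 𝒜-≡ {π = split𝒜 j (fromList𝒜 L)} {lookup λs j} (split-merged j))
            (Vec.tabulate∘lookup λs)
      where
      L = unionLifts λs
      split-merged : ∀ j → split j (fromList L) ≡ proj₁ (lookup λs j)
      split-merged j = sorted-≡ (split-sorted j (fromList-sorted L)) (sorted (lookup λs j)) split⊆ ⊆split
        where
        split⊆ : split j (fromList L) ⊆ proj₁ (lookup λs j)
        split⊆ {p} p∈ with ∈-unionLifts⁻ λs (fromList-⊆ L (∈-split⁻ (fromList L) p∈))
        ... | i , p′ , p′∈ , lift≡ with lift-injective {i = j} {j = i} {p = p} {q = p′} lift≡
        ...   | refl , refl = p′∈
        ⊆split : proj₁ (lookup λs j) ⊆ split j (fromList L)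
        ⊆split p∈ = ∈-split⁺ (fromList L) (⊆-fromList L (∈-unionLifts⁺ λs j p∈))

    private
      splitₘ-positive : ∀ (π : [𝒜]ₘ m) → All Positive (proj₁ (proj₁ π))
      splitₘ-positive (π , m∣) = ∣⇒positive (λ ()) (sorted π) m∣

      lookup-splitₘ : ∀ π j → proj₁ (lookup (splitₘ π) j) ≡ split j (proj₁ (proj₁ π))
      lookup-splitₘ (π , _) j = cong proj₁ (Vec.lookup∘tabulate (λ i → split𝒜 i π) j)

    mergeₘ∘splitₘ : ∀ π → mergeₘ (splitₘ π) ≡ π
    mergeₘ∘splitₘ π@((xs , _) , _) = [𝒜]ₘ-≡ (sorted-≡ (fromList-sorted L) (sorted (proj₁ π)) merged⊆ ⊆merged)
      where
      L = unionLifts (splitₘ π)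
      merged⊆ : fromList L ⊆ xs
      merged⊆ q∈ with ∈-unionLifts⁻ (splitₘ π) (fromList-⊆ L q∈)
      ... | j , p , p∈ , refl = ∈-split⁻ xs (subst (p ∈_) (lookup-splitₘ π j) p∈)
      ⊆merged : xs ⊆ fromList L
      ⊆merged {q} q∈ with positive⇒lifted q (All.lookup (splitₘ-positive π) q∈)
      ... | lifted j p =
        ⊆-fromList L (∈-unionLifts⁺ (splitₘ π) j (subst (p ∈_) (sym (lookup-splitₘ π j)) (∈-split⁺ xs q∈)))

    [𝒜]ₘ↔𝒜^m : [𝒜]ₘ m ↔ Vec (𝒜 m) m
    [𝒜]ₘ↔𝒜^m = mk↔ₛ′ splitₘ mergeₘ splitₘ∘mergeₘ mergeₘ∘splitₘ

    ∣∣ₚ-splitₘ : ∀ π → ∣ proj₁ π ∣ₚ ≡ m * Vec.sum (Vec.map ∣_∣ₚ (splitₘ π))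
    ∣∣ₚ-splitₘ π@(π₀ , _) = trans (sum≡splitSum size size m (λ _ _ → refl) (splitₘ-positive π))
                                  (cong (λ v → m * Vec.sum v) (Vec.tabulate-∘ ∣_∣ₚ (λ j → split𝒜 j π₀)))

    ℓ-splitₘ : ∀ π → ℓ (proj₁ π) ≡ Vec.sum (Vec.map ℓ (splitₘ π))
    ℓ-splitₘ π@((xs , _) , _) = begin
      length xs                                    ≡⟨ length≡sum-map-1 xs ⟩
      sum (map one xs)                             ≡⟨ sum≡splitSum one one 1 (λ _ _ → refl) (splitₘ-positive π) ⟩
      1 * splitSum one xs                          ≡⟨ ℕ.*-identityˡ _ ⟩
      splitSum one xs                              ≡⟨ cong Vec.sum (Vec.tabulate-cong λ j → length≡sum-map-1 (split j xs)) ⟨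
      Vec.sum (tabulate λ j → length (split j xs)) ≡⟨ cong Vec.sum (Vec.tabulate-∘ ℓ (λ j → split𝒜 j (proj₁ π))) ⟩
      Vec.sum (Vec.map ℓ (splitₘ π))               ∎
      where
      open ≡-Reasoning
      one : Part m → ℕ
      one _ = 1

open import Data.Nat using (ℕ; suc; _≤_; _*_; s≤s; z≤n)
open import Data.Vec using (Vec; sum; map)
open import Data.Product using (Σ; _×_; _,_; proj₁)
open import Function.Bundles using (_↔_; Inverse)
open import Relation.Binary.PropositionalEquality using (_≡_)
open PowerSeries using (a-convolutive)
open Partitions using ([𝒜]ₘ↔𝒜^m; ∣∣ₚ-splitₘ; ℓ-splitₘ)

theorem5p2 : (m : ℕ) → 2 ≤ m →
    Σ ([𝒜]ₘ m ↔ Vec (𝒜 m) m)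
      (λ f → (π : [𝒜]ₘ m) →
          (∣ proj₁ π ∣ₚ ≡ m * sum (map ∣_∣ₚ (Inverse.to f π)))
          × (ℓ (proj₁ π) ≡ sum (map ℓ (Inverse.to f π))))
    × ((n : ℕ) → a m (m * n) ≡ (a m ^ₛ m) n)
theorem5p2 (suc (suc k)) (s≤s (s≤s z≤n)) =
  ([𝒜]ₘ↔𝒜^m , λ π → ∣∣ₚ-splitₘ π , ℓ-splitₘ π) , a-convolutive
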